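{- Let $s$, $t$ and $k$ be positive integers with $t\geq s\geq k$. Then \[ TC_{k}(K_{s,t})=\begin{cases} t-k+2, & \text{if } k\leq s\leq 3k-2;\\ s+t-4k+4, & \text{if } s\geq 3k-1. \end{cases} \]
   Context: $K_{s,t}$ is the complete bipartite graph with partite sets of sizes $s$ and $t$. Let $G$ be a graph with minimum degree $\delta(G)\geq k$. A set $S\subseteq V(G)$ is a total $k$-dominating set of $G$ if every vertex $v\in V(G)$ has at least $k$ neighbors in $S$. Two disjoint sets $A,B\subseteq V(G)$ form a total $k$-coalition if neither $A$ nor $B$ is a total $k$-dominating set of $G$ but $A\cup B$ is a total $k$-dominating set of $G$. A total $k$-coalition partition of $G$ is a partition $\Omega$ of $V(G)$ in which every set forms a total $k$-coalition with another set of $\Omega$. The total $k$-coalition number $TC_k(G)$ is the maximum cardinality of a total $k$-coalition partition of $G$. -}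

module Defs where

open import Data.Nat using (ℕ; _≤_; _<ᵇ_; _+_)
open import Data.Bool using (Bool; true; false; _xor_; if_then_else_)
open import Data.Fin using (Fin; toℕ; _≟_)
open import Data.Fin.Subset using (Subset; _∩_; _∪_; ∣_∣; inside; outside)
open import Data.Vec using (tabulate)
open import Data.Product using (Σ; _×_; ∃)
open import Relation.Nullary using (¬_; does)
open import Relation.Binary.PropositionalEquality using (_≡_; _≢_)

record Graph : Set where
  field
    n     : ℕ
    adj   : Fin n → Fin n → Bool
    sym   : ∀ u v → adj u v ≡ adj v u
    irrefl : ∀ v → adj v v ≡ false
open Graph public

nbhd : (G : Graph) → Fin (n G) → Subset (n G)
nbhd G v = tabulate (λ u → if adj G v u then inside else outside)

IsTotalKDom : (G : Graph) → ℕ → Subset (n G) → Set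
IsTotalKDom G k S = ∀ v → k ≤ ∣ nbhd G v ∩ S ∣

record Partition (G : Graph) (m : ℕ) : Set where
  field
    label : Fin (n G) → Fin m
    nonempty : ∀ i → ∃ λ v → label v ≡ i

part : {G : Graph} {m : ℕ} → Partition G m → Fin m → Subset (n G)
part P i = tabulate (λ v → if does (Partition.label P v ≟ i) then inside else outside)

TotalKCoalition : {G : Graph} {m : ℕ} → ℕ → Partition G m → Fin m → Fin m → Set
TotalKCoalition {G} k P i j =
  i ≢ j × ¬ IsTotalKDom G k (part P i) × ¬ IsTotalKDom G k (part P j)
        × IsTotalKDom G k (part P i ∪ part P j)

IsTotalKCoalitionPartition : (G : Graph) {m : ℕ} → ℕ → Partition G m → Set
IsTotalKCoalitionPartition G k P = ∀ i → ∃ λ j → TotalKCoalition {G} k P i j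

TCₖ≡ : (G : Graph) → ℕ → ℕ → Set
TCₖ≡ G k m =
  (Σ (Partition G m) λ P → IsTotalKCoalitionPartition G k P)
  × (∀ m' → (P : Partition G m') → IsTotalKCoalitionPartition G k P → m' ≤ m)

-- complete bipartite graph K_{s,t} on Fin (s + t): vertices with index < s form
-- one side, the remaining t vertices the other side
side : ∀ {N} → ℕ → Fin N → Bool
side s v = toℕ v <ᵇ s

private
  xor-comm : ∀ a b → a xor b ≡ b xor a
  xor-comm true true = Relation.Binary.PropositionalEquality.refl
  xor-comm true false = Relation.Binary.PropositionalEquality.refl
  xor-comm false true = Relation.Binary.PropositionalEquality.refl
  xor-comm false false = Relation.Binary.PropositionalEquality.refl
  xor-self : ∀ a → a xor a ≡ false
  xor-self true = Relation.Binary.PropositionalEquality.refl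
  xor-self false = Relation.Binary.PropositionalEquality.refl

K : ℕ → ℕ → Graph
K s t = record
  { n = s + t
  ; adj = λ u v → side s u xor side s v
  ; sym = λ u v → xor-comm (side s u) (side s v)
  ; irrefl = λ v → xor-self (side s v)
  }

-- In K_{s,t} a set is total k-dominating iff it has at least k vertices on each side, so a
-- total k-coalition partition is governed by the side sizes (a_i, b_i) of its m parts. If two coalitions {A,B} and {C,D} are disjoint, then
-- A,B,C,D contain at least 4k vertices and every other part at least one, so
-- m + 4k ≤ s + t + 4. Otherwise some part c forms a coalition with every other part; c is
-- short on one side, say a_c < k, so every other part meets that side and
-- m + k ≤ s + 2 ≤ t + 2. The larger of the two bounds is attained by X plus k−1 vertices of Y
-- as one part, or by two parts of sizes (k−1, k) and (k, k−1), all other vertices being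
-- singletons.

module Submission where

open import Defs hiding (sym)
open import Data.Bool using (Bool; true; false; if_then_else_; _∨_; _∧_; _xor_)
open import Data.Empty using (⊥-elim)
open import Data.Fin as Fin using (Fin; zero; suc; _↑ˡ_; _↑ʳ_; _≟_; fromℕ<)
open import Data.Fin.Properties using (suc-injective; ↑ˡ-injective; ↑ʳ-injective; any?)
open import Data.Fin.Subset using (Subset; ∣_∣; inside; outside; _∩_; _∪_)
open import Data.List using (List; []; _∷_; map; length)
open import Data.List.Membership.Propositional using (_∉_)
open import Data.List.Properties using (map-cong-local)
open import Data.List.Relation.Unary.All as All using ([]; _∷_)
open import Data.List.Relation.Unary.AllPairs using ([]; _∷_)
open import Data.List.Relation.Unary.Any using (here; there)
open import Data.List.Relation.Unary.Unique.Propositional using (Unique)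
open import Data.Nat using (ℕ; zero; suc; _≤_; _<_; _+_; _*_; _∸_; z≤n; s≤s; _≤?_)
import Data.Nat.ListAction as List
open import Data.Nat.Properties
  using ( +-0-commutativeMonoid; +-assoc; +-comm; +-identityʳ; +-suc
        ; ≤-refl; ≤-reflexive; ≤-trans; <-≤-trans; <⇒≱; ≰⇒>; n≤1+n; m≤m+n; m≤n+m
        ; +-mono-≤; +-monoˡ-≤; +-monoʳ-≤; *-monoʳ-≤; +-cancelˡ-≤; +-cancelˡ-<
        ; m+n∸m≡n; m+n∸n≡m; m∸n+n≡m; m≤n+m∸n; +-∸-comm; m+n≤o⇒m≤o∸n; m≤n⇒∃[o]m+o≡n
        ; module ≤-Reasoning )
open import Data.Nat.Tactic.RingSolver using (solve-∀)
open import Algebra.Properties.CommutativeMonoid.Sum +-0-commutativeMonoid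
  using (sum; sum-syntax; sum-cong-≗; sum-replicate-zero; ∑-distrib-+; ∑-comm)
open import Data.Product using (Σ; ∃; _×_; _,_; proj₁; proj₂; map₂)
open import Data.Sum using (_⊎_; inj₁; inj₂; [_,_]; fromInj₁; fromInj₂)
open import Data.Vec using ([]; _∷_; lookup; tabulate)
open import Data.Vec.Functional using (_++_; updateAt)
open import Data.Vec.Functional.Properties using (lookup-++ˡ; lookup-++ʳ; updateAt-updates; updateAt-minimal)
open import Data.Vec.Properties using (lookup∘tabulate; lookup-zipWith)
open import Function using (_∘_; const; _⇔_; mk⇔; Equivalence)
open import Function.Definitions using (Injective)
open import Relation.Binary.PropositionalEquality
  using (_≡_; _≢_; _≗_; refl; sym; trans; cong; cong₂; subst; subst₂; ≢-sym; module ≡-Reasoning)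
open import Relation.Nullary using (¬_; does; yes; no; ¬?; _×-dec_)
open import Relation.Nullary.Decidable using (dec-true; dec-false)
open import Relation.Unary using (Decidable)

n≤sum : ∀ {n} {g : Fin n → ℕ} → (∀ i → 1 ≤ g i) → n ≤ sum g
n≤sum {zero}  pos = z≤n
n≤sum {suc n} pos = +-mono-≤ (pos zero) (n≤sum (pos ∘ suc))

sum-ones : ∀ n → sum {n} (const 1) ≡ n
sum-ones zero    = refl
sum-ones (suc n) = cong suc (sum-ones n)

sum-↑ : ∀ m {n} (f : Fin (m + n) → ℕ) → sum f ≡ sum (f ∘ (_↑ˡ n)) + sum (f ∘ (m ↑ʳ_))
sum-↑ zero    f = refl
sum-↑ (suc m) f = trans (cong (f zero +_) (sum-↑ m (f ∘ suc))) (sym (+-assoc (f zero) _ _))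

sum-updateAt : ∀ {n} (g : Fin n → ℕ) i v → sum (updateAt g i (const v)) + g i ≡ sum g + v
sum-updateAt g zero v = swap v (sum (g ∘ suc)) (g zero)
  where
  swap : ∀ x y z → x + y + z ≡ z + y + x
  swap = solve-∀
sum-updateAt g (suc i) v = begin
  g zero + sum (updateAt (g ∘ suc) i (const v)) + g (suc i)   ≡⟨ +-assoc (g zero) _ _ ⟩
  g zero + (sum (updateAt (g ∘ suc) i (const v)) + g (suc i)) ≡⟨ cong (g zero +_) (sum-updateAt (g ∘ suc) i v) ⟩
  g zero + (sum (g ∘ suc) + v)                                ≡⟨ +-assoc (g zero) _ v ⟨
  g zero + sum (g ∘ suc) + v                                  ∎
  where open ≡-Reasoning

-- Induction on xs, after resetting g to 1 at the head so that it stays positive off the tail.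
sum-lowerBound : ∀ {n} (g : Fin n → ℕ) {xs : List (Fin n)} → Unique xs → (∀ i → i ∉ xs → 1 ≤ g i)
  → List.sum (map g xs) + n ≤ sum g + length xs
sum-lowerBound g {[]} [] pos = ≤-trans (n≤sum (λ i → pos i λ ())) (≤-reflexive (sym (+-identityʳ (sum g))))
sum-lowerBound {n} g {x ∷ xs} (x∉xs ∷ unique) pos = begin
  g x + List.sum (map g xs) + n    ≡⟨ +-assoc (g x) _ n ⟩
  g x + (List.sum (map g xs) + n)  ≡⟨ cong (λ σ → g x + (List.sum σ + n)) (map-cong-local (All.map g≡g₁ x∉xs)) ⟩
  g x + (List.sum (map g₁ xs) + n) ≤⟨ +-monoʳ-≤ (g x) (sum-lowerBound g₁ unique pos₁) ⟩
  g x + (sum g₁ + length xs)       ≡⟨ regroup (g x) (sum g₁) (length xs) ⟩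
  sum g₁ + g x + length xs         ≡⟨ cong (_+ length xs) (sum-updateAt g x 1) ⟩
  sum g + 1 + length xs            ≡⟨ +-assoc (sum g) 1 _ ⟩
  sum g + suc (length xs)          ∎
  where
  open ≤-Reasoning
  regroup : ∀ x y z → x + (y + z) ≡ y + x + z
  regroup = solve-∀
  g₁ : Fin n → ℕ
  g₁ = updateAt g x (const 1)
  g≡g₁ : ∀ {y} → x ≢ y → g y ≡ g₁ y
  g≡g₁ x≢y = sym (updateAt-minimal _ x g (x≢y ∘ sym))
  pos₁ : ∀ i → i ∉ xs → 1 ≤ g₁ i
  pos₁ i i∉xs with i ≟ x
  ... | yes refl = ≤-reflexive (sym (updateAt-updates x g))
  ... | no i≢x   = subst (1 ≤_) (g≡g₁ (i≢x ∘ sym))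
                     (pos i λ { (here i≡x) → i≢x i≡x ; (there i∈xs) → i∉xs i∈xs })

indicator : Bool → ℕ
indicator b = if b then 1 else 0

count : ∀ {n} → (Fin n → Bool) → ℕ
count p = sum (indicator ∘ p)

∣p∣≡count : ∀ {n} (p : Subset n) → ∣ p ∣ ≡ count (lookup p)
∣p∣≡count []          = refl
∣p∣≡count (true ∷ p)  = cong suc (∣p∣≡count p)
∣p∣≡count (false ∷ p) = ∣p∣≡count p

count-cong : ∀ {n} {p q : Fin n → Bool} → p ≗ q → count p ≡ count q
count-cong p≗q = sum-cong-≗ (cong indicator ∘ p≗q)

count-false : ∀ n → count {n} (const false) ≡ 0
count-false = sum-replicate-zero

count-witness : ∀ {n} {P : Fin n → Set} (P? : Decidable P) → 1 ≤ count (does ∘ P?) → ∃ P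
count-witness {suc n} P? pos with P? zero
... | yes P0 = zero , P0
... | no _ with count-witness (P? ∘ suc) pos
...   | v , Pv = suc v , Pv

count-≟ : ∀ {m} (j : Fin m) → count (λ i → does (j ≟ i)) ≡ 1
count-≟ {suc m} zero    = cong suc (count-false m)
count-≟ {suc m} (suc j) = count-≟ j

fibre : ∀ {n m} → (Fin n → Fin m) → Fin m → ℕ
fibre f i = count (λ v → does (f v ≟ i))

∑-fibre : ∀ {n m} (f : Fin n → Fin m) → ∑[ i < m ] fibre f i ≡ n
∑-fibre {n} {m} f = begin
  ∑[ i < m ] ∑[ v < n ] indicator (does (f v ≟ i)) ≡⟨ ∑-comm (λ i v → indicator (does (f v ≟ i))) ⟩
  ∑[ v < n ] ∑[ i < m ] indicator (does (f v ≟ i)) ≡⟨ sum-cong-≗ (count-≟ ∘ f) ⟩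
  sum {n} (const 1)                                 ≡⟨ sum-ones n ⟩
  n                                                 ∎
  where open ≡-Reasoning

fibre-cong : ∀ {n m} {f g : Fin n → Fin m} → f ≗ g → fibre f ≗ fibre g
fibre-cong f≗g i = count-cong (λ v → cong (λ w → does (w ≟ i)) (f≗g v))

fibre-++ : ∀ {m n k} (f : Fin m → Fin k) (g : Fin n → Fin k) i → fibre (f ++ g) i ≡ fibre f i + fibre g i
fibre-++ {m} f g i = trans (sum-↑ m _) (cong₂ _+_ (fibre-cong (lookup-++ˡ f g) i) (fibre-cong (lookup-++ʳ f g) i))

fibre-∉ : ∀ {n m} (f : Fin n → Fin m) {i} → (∀ v → f v ≢ i) → fibre f i ≡ 0
fibre-∉ {n} f {i} ∉ = trans (count-cong (λ v → dec-false (f v ≟ i) (∉ v))) (count-false n)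

fibre-const : ∀ n {m} (i : Fin m) → fibre {n} (const i) i ≡ n
fibre-const n i = trans (count-cong {n} (λ _ → dec-true (i ≟ i) refl)) (sum-ones n)

fibre-injective : ∀ {n m} {f : Fin n → Fin m} → Injective _≡_ _≡_ f → ∀ v → fibre f (f v) ≡ 1
fibre-injective {f = f} inj v = trans (count-cong same) (count-≟ v)
  where
  same : ∀ w → does (f w ≟ f v) ≡ does (v ≟ w)
  same w with v ≟ w
  ... | yes refl = dec-true (f w ≟ f w) refl
  ... | no v≢w   = dec-false (f w ≟ f v) (v≢w ∘ sym ∘ inj)

fibre-∃ : ∀ {n m} (f : Fin n → Fin m) {i} → 1 ≤ fibre f i → ∃ λ v → f v ≡ i
fibre-∃ f {i} = count-witness (λ v → f v ≟ i)

_◃_ : ∀ p {r m} → (Fin r → Fin m) → Fin (p + r) → Fin (suc m)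
p ◃ f = const zero ++ (Fin.suc ∘ f)

fibre-◃-zero : ∀ p {r m} (f : Fin r → Fin m) → fibre (p ◃ f) zero ≡ p
fibre-◃-zero p {m = m} f = trans (fibre-++ {p} (const zero) (Fin.suc ∘ f) zero)
  (trans (cong₂ _+_ (fibre-const p {suc m} zero) (fibre-∉ (Fin.suc ∘ f) {zero} (λ _ ()))) (+-identityʳ p))

fibre-◃-suc : ∀ p {r m} (f : Fin r → Fin m) i → fibre (p ◃ f) (suc i) ≡ fibre f i
fibre-◃-suc p f i = trans (fibre-++ {p} (const zero) (Fin.suc ∘ f) (suc i))
  (cong (_+ fibre f i) (fibre-∉ {p} (const zero) {suc i} (λ _ ())))

lookup-tabulate-if : ∀ {n} (p : Fin n → Bool) v → lookup (tabulate (λ u → if p u then inside else outside)) v ≡ p v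
lookup-tabulate-if p v rewrite lookup∘tabulate (λ u → if p u then inside else outside) v with p v
... | true  = refl
... | false = refl

module _ {G : Graph} {m} (P : Partition G m) where

  private
    label : Fin (n G) → Fin m
    label = Partition.label P

  lookup-part : ∀ i v → lookup (part P i) v ≡ does (label v ≟ i)
  lookup-part i = lookup-tabulate-if (λ u → does (label u ≟ i))

  count-part : ∀ {r} (ι : Fin r → Fin (n G)) i → count (lookup (part P i) ∘ ι) ≡ fibre (label ∘ ι) i
  count-part ι i = count-cong (lookup-part i ∘ ι)

  count-part∪ : ∀ {r} (ι : Fin r → Fin (n G)) {i j} → i ≢ j
    → count (lookup (part P i ∪ part P j) ∘ ι) ≡ fibre (label ∘ ι) i + fibre (label ∘ ι) j
  count-part∪ ι {i} {j} i≢j =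
    trans (sum-cong-≗ disjoint) (∑-distrib-+ (λ w → indicator (does (label (ι w) ≟ i))) _)
    where
    disjoint : ∀ w → indicator (lookup (part P i ∪ part P j) (ι w))
                   ≡ indicator (does (label (ι w) ≟ i)) + indicator (does (label (ι w) ≟ j))
    disjoint w rewrite lookup-zipWith _∨_ (ι w) (part P i) (part P j) | lookup-part i (ι w) | lookup-part j (ι w)
      with label (ι w) ≟ i | label (ι w) ≟ j
    ... | yes refl | yes refl = ⊥-elim (i≢j refl)
    ... | yes _    | no _     = refl
    ... | no _     | yes _    = refl
    ... | no _     | no _     = refl

Dominating : ℕ → ℕ → ℕ → Set
Dominating k x y = k ≤ x × k ≤ y

-- TotalKCoalition in K_{s,t}, when a i and b i count the vertices of part i on the two sides.
record Coalition {m} (k : ℕ) (a b : Fin m → ℕ) (i j : Fin m) : Set where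
  constructor coalition
  field
    distinct     : i ≢ j
    ¬dominating₁ : ¬ Dominating k (a i) (b i)
    ¬dominating₂ : ¬ Dominating k (a j) (b j)
    dominating₁₂ : Dominating k (a i + a j) (b i + b j)

¬dominatingˡ : ∀ {k x y} → x < k → ¬ Dominating k x y
¬dominatingˡ x<k (k≤x , _) = <⇒≱ x<k k≤x

¬dominatingʳ : ∀ {k x y} → y < k → ¬ Dominating k x y
¬dominatingʳ y<k (_ , k≤y) = <⇒≱ y<k k≤y

coalition-of : ∀ {m k} {a b : Fin m → ℕ} {i j x y x′ y′} → a i ≡ x → b i ≡ y → a j ≡ x′ → b j ≡ y′
  → i ≢ j → ¬ Dominating k x y → ¬ Dominating k x′ y′ → Dominating k (x + x′) (y + y′) → Coalition k a b i j
coalition-of refl refl refl refl = coalition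

coalition-cong : ∀ {m k} {a b a′ b′ : Fin m → ℕ} {i j}
  → a ≗ a′ → b ≗ b′ → Coalition k a b i j → Coalition k a′ b′ i j
coalition-cong {i = i} {j} a≗a′ b≗b′ (coalition i≢j ¬dᵢ ¬dⱼ dᵢⱼ)
  rewrite a≗a′ i | a≗a′ j | b≗b′ i | b≗b′ j = coalition i≢j ¬dᵢ ¬dⱼ dᵢⱼ

module _ {m k : ℕ} {a b : Fin m → ℕ} where

  coalition-sym : ∀ {i j} → Coalition k a b i j → Coalition k a b j i
  coalition-sym {i} {j} (coalition i≢j ¬dᵢ ¬dⱼ (kˡ , kʳ)) =
    coalition (≢-sym i≢j) ¬dⱼ ¬dᵢ (subst (k ≤_) (+-comm (a i) (a j)) kˡ , subst (k ≤_) (+-comm (b i) (b j)) kʳ)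

  -- If part i were empty, part j alone would be dominating.
  coalition⇒nonempty : ∀ {i j} → Coalition k a b i j → 1 ≤ a i + b i
  coalition⇒nonempty {i} (coalition _ _ ¬dⱼ dᵢⱼ) with a i | b i
  ... | suc _ | _     = s≤s z≤n
  ... | zero  | suc _ = s≤s z≤n
  ... | zero  | zero  = ⊥-elim (¬dⱼ dᵢⱼ)

-- Graphs without isolated vertices

Universal : ∀ {m} → (Fin m → Fin m → Set) → Fin m → Set
Universal _~_ c = ∀ w → w ≢ c → c ~ w

record DisjointEdges {m} (_~_ : Fin m → Fin m → Set) : Set where
  field
    u₁ v₁ u₂ v₂ : Fin m
    u₁~v₁       : u₁ ~ v₁
    u₂~v₂       : u₂ ~ v₂
    distinct    : Unique (u₁ ∷ v₁ ∷ u₂ ∷ v₂ ∷ [])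

module _ {m} {_~_ : Fin m → Fin m → Set}
  (~-sym : ∀ {i j} → i ~ j → j ~ i) (~-irrefl : ∀ {i j} → i ~ j → i ≢ j) (partner : ∀ i → ∃ (i ~_)) where

  private
    p : Fin m → Fin m
    p = proj₁ ∘ partner

    ~p : ∀ i → i ~ p i
    ~p = proj₂ ∘ partner

    Avoids : Fin m → Fin m → Fin m → Set
    Avoids a b w = w ≢ a × w ≢ b

    avoids? : ∀ a b → Decidable (Avoids a b)
    avoids? a b w = ¬? (w ≟ a) ×-dec ¬? (w ≟ b)

    partner-into : ∀ {a b} → ¬ ∃ (λ w → Avoids a b w × Avoids a b (p w))
      → ∀ w → Avoids a b w → p w ≡ a ⊎ p w ≡ b
    partner-into {a} {b} ¬edge w w-avoids with p w ≟ a | p w ≟ b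
    ... | yes pw≡a | _        = inj₁ pw≡a
    ... | no _     | yes pw≡b = inj₂ pw≡b
    ... | no pw≢a  | no pw≢b  = ⊥-elim (¬edge (w , w-avoids , pw≢a , pw≢b))

    universal : ∀ {c c′} → c′ ~ c → (∀ w → w ≢ c → w ≢ c′ → p w ≡ c) → Universal _~_ c
    universal {c′ = c′} c′~c into w w≢c with w ≟ c′
    ... | yes refl = ~-sym c′~c
    ... | no w≢c′  = ~-sym (subst (w ~_) (into w w≢c w≢c′) (~p w))

    -- Either some partner edge avoids {v, u}; or all of them meet it, and then two of them
    -- meet it in different endpoints, or one endpoint receives all of them.
    fromEdge : ∀ v u → v ~ u → DisjointEdges _~_ ⊎ ∃ (Universal _~_)
    fromEdge v u v~u with any? (λ w → avoids? v u w ×-dec avoids? v u (p w))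
    ... | yes (w , (w≢v , w≢u) , (pw≢v , pw≢u)) = inj₁ record
      { u₁~v₁ = v~u ; u₂~v₂ = ~p w
      ; distinct = (~-irrefl v~u ∷ ≢-sym w≢v ∷ ≢-sym pw≢v ∷ []) ∷ (≢-sym w≢u ∷ ≢-sym pw≢u ∷ [])
                 ∷ (~-irrefl (~p w) ∷ []) ∷ [] ∷ []
      }
    ... | no ¬edge with any? (λ w → avoids? v u w ×-dec (p w ≟ v)) | any? (λ w → avoids? v u w ×-dec (p w ≟ u))
    ...   | yes (w₁ , (w₁≢v , w₁≢u) , pw₁≡v) | yes (w₂ , (w₂≢v , w₂≢u) , pw₂≡u) = inj₁ record
      { u₁~v₁ = subst (w₁ ~_) pw₁≡v (~p w₁) ; u₂~v₂ = subst (w₂ ~_) pw₂≡u (~p w₂)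
      ; distinct = (w₁≢v ∷ w₁≢w₂ ∷ w₁≢u ∷ []) ∷ (≢-sym w₂≢v ∷ ~-irrefl v~u ∷ []) ∷ (w₂≢u ∷ []) ∷ [] ∷ []
      }
      where
      w₁≢w₂ : w₁ ≢ w₂
      w₁≢w₂ w₁≡w₂ = ~-irrefl v~u (trans (sym pw₁≡v) (trans (cong p w₁≡w₂) pw₂≡u))
    ...   | no ¬into-v | _ = inj₂ (u , universal v~u λ w w≢u w≢v →
      fromInj₂ (λ pw≡v → ⊥-elim (¬into-v (w , (w≢v , w≢u) , pw≡v))) (partner-into ¬edge w (w≢v , w≢u)))
    ...   | _ | no ¬into-u = inj₂ (v , universal (~-sym v~u) λ w w≢v w≢u →
      fromInj₁ (λ pw≡u → ⊥-elim (¬into-u (w , (w≢v , w≢u) , pw≡u))) (partner-into ¬edge w (w≢v , w≢u)))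

  disjointEdges⊎universal : Fin m → DisjointEdges _~_ ⊎ ∃ (Universal _~_)
  disjointEdges⊎universal v = fromEdge v (p v) (~p v)

-- Upper bounds

universal-bound : ∀ {m k} (g : Fin m → ℕ) {c d} → d ≢ c → g c < k → (∀ w → w ≢ c → k ≤ g c + g w)
  → m + k ≤ sum g + 2
universal-bound {m} {k} g {c} {d} d≢c gc<k covers = begin
  m + k                             ≤⟨ +-monoʳ-≤ m (covers d d≢c) ⟩
  m + (g c + g d)                   ≡⟨ rearrange m (g c) (g d) ⟩
  List.sum (map g (c ∷ d ∷ [])) + m ≤⟨ sum-lowerBound g ((≢-sym d≢c ∷ []) ∷ [] ∷ [])
                                                         (λ w w∉ → positive w (w∉ ∘ here)) ⟩
  sum g + 2                         ∎
  where
  open ≤-Reasoning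
  rearrange : ∀ m x y → m + (x + y) ≡ x + (y + 0) + m
  rearrange = solve-∀
  positive : ∀ w → w ≢ c → 1 ≤ g w
  positive w w≢c = +-cancelˡ-< (g c) 0 (g w)
    (subst (_< g c + g w) (sym (+-identityʳ (g c))) (<-≤-trans gc<k (covers w w≢c)))

disjointEdges-bound : ∀ {m k} {a b : Fin m → ℕ} → (∀ i → 1 ≤ a i + b i) → DisjointEdges (Coalition k a b)
  → m + 4 * k ≤ sum a + sum b + 4
disjointEdges-bound {m} {k} {a} {b} nonempty e = begin
  m + 4 * k                                     ≡⟨ regroup m k ⟩
  (k + k) + (k + k) + m                         ≤⟨ +-monoˡ-≤ m (+-mono-≤ (covers u₁~v₁) (covers u₂~v₂)) ⟩
  (g u₁ + g v₁) + (g u₂ + g v₂) + m             ≡⟨ cong (_+ m) (flatten (g u₁) (g v₁) (g u₂) (g v₂)) ⟩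
  List.sum (map g (u₁ ∷ v₁ ∷ u₂ ∷ v₂ ∷ [])) + m ≤⟨ sum-lowerBound g distinct (λ i _ → nonempty i) ⟩
  sum g + 4                                     ≡⟨ cong (_+ 4) (∑-distrib-+ a b) ⟩
  sum a + sum b + 4                             ∎
  where
  open ≤-Reasoning
  open DisjointEdges e
  g : Fin m → ℕ
  g i = a i + b i
  regroup : ∀ m k → m + 4 * k ≡ (k + k) + (k + k) + m
  regroup = solve-∀
  flatten : ∀ w x y z → (w + x) + (y + z) ≡ w + (x + (y + (z + 0)))
  flatten = solve-∀
  swap : ∀ w x y z → (w + x) + (y + z) ≡ (w + y) + (x + z)
  swap = solve-∀
  covers : ∀ {i j} → Coalition k a b i j → k + k ≤ g i + g j
  covers {i} {j} (coalition _ _ _ (kˡ , kʳ)) = ≤-trans (+-mono-≤ kˡ kʳ) (≤-reflexive (swap (a i) (a j) (b i) (b j)))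

coalition-bound : ∀ {m k} {a b : Fin m → ℕ} → (∀ i → ∃ (Coalition k a b i)) → Fin m
  → m + k ≤ sum a + 2 ⊎ m + k ≤ sum b + 2 ⊎ m + 4 * k ≤ sum a + sum b + 4
coalition-bound {k = k} {a} {b} partner v with disjointEdges⊎universal coalition-sym Coalition.distinct partner v
... | inj₁ edges = inj₂ (inj₂ (disjointEdges-bound (coalition⇒nonempty ∘ proj₂ ∘ partner) edges))
... | inj₂ (c , universal) with partner c
...   | d , coalition c≢d ¬dom-c _ _ with k ≤? a c
...     | no k≰ac  = inj₁ (universal-bound a (≢-sym c≢d) (≰⇒> k≰ac)
                        (λ w w≢c → proj₁ (Coalition.dominating₁₂ (universal w w≢c))))
...     | yes k≤ac = inj₂ (inj₁ (universal-bound b (≢-sym c≢d) (≰⇒> λ k≤bc → ¬dom-c (k≤ac , k≤bc))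
                        (λ w w≢c → proj₂ (Coalition.dominating₁₂ (universal w w≢c)))))

-- Complete bipartite graphs

side-↑ˡ : ∀ {s} t (x : Fin s) → side {s + t} s (x ↑ˡ t) ≡ true
side-↑ˡ t zero    = refl
side-↑ˡ t (suc x) = side-↑ˡ t x

side-↑ʳ : ∀ s {t} (y : Fin t) → side {s + t} s (s ↑ʳ y) ≡ false
side-↑ʳ zero    y = refl
side-↑ʳ (suc s) y = side-↑ʳ s y

data SplitView (s t : ℕ) : Fin (s + t) → Set where
  inˡ : ∀ x → SplitView s t (x ↑ˡ t)
  inʳ : ∀ y → SplitView s t (s ↑ʳ y)

splitView : ∀ s t v → SplitView s t v
splitView zero    t v       = inʳ v
splitView (suc s) t zero    = inˡ zero
splitView (suc s) t (suc v) with splitView s t v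
... | inˡ x = inˡ (suc x)
... | inʳ y = inʳ y

↑ˡ≢↑ʳ : ∀ {m n} (x : Fin m) (y : Fin n) → x ↑ˡ n ≢ m ↑ʳ y
↑ˡ≢↑ʳ zero    y ()
↑ˡ≢↑ʳ (suc x) y eq = ↑ˡ≢↑ʳ x y (suc-injective eq)

HasTotalKCoalitionPartition : Graph → ℕ → ℕ → Set
HasTotalKCoalitionPartition G k m = Σ (Partition G m) (IsTotalKCoalitionPartition G k)

module Bipartite (s t : ℕ) where

  countˡ countʳ : Subset (s + t) → ℕ
  countˡ S = count (lookup S ∘ (_↑ˡ t))
  countʳ S = count (lookup S ∘ (s ↑ʳ_))

  lookup-nbhd∩ : ∀ u S v → lookup (nbhd (K s t) u ∩ S) v ≡ (side s u xor side s v) ∧ lookup S v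
  lookup-nbhd∩ u S v = trans (lookup-zipWith _∧_ v (nbhd (K s t) u) S)
    (cong (_∧ lookup S v) (lookup-tabulate-if (λ w → side s u xor side s w) v))

  degree-↑ˡ : ∀ x S → ∣ nbhd (K s t) (x ↑ˡ t) ∩ S ∣ ≡ countʳ S
  degree-↑ˡ x S = begin
    ∣ N ∩ S ∣                       ≡⟨ ∣p∣≡count (N ∩ S) ⟩
    count (lookup (N ∩ S))          ≡⟨ sum-↑ s _ ⟩
    countˡ (N ∩ S) + countʳ (N ∩ S) ≡⟨ cong₂ _+_ (trans (count-cong same-side) (count-false s))
                                                   (count-cong other-side) ⟩
    0 + countʳ S                    ∎
    where
    open ≡-Reasoning
    N : Subset (s + t)
    N = nbhd (K s t) (x ↑ˡ t)
    same-side : ∀ x′ → lookup (N ∩ S) (x′ ↑ˡ t) ≡ false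
    same-side x′ rewrite lookup-nbhd∩ (x ↑ˡ t) S (x′ ↑ˡ t) | side-↑ˡ t x | side-↑ˡ t x′ = refl
    other-side : ∀ y → lookup (N ∩ S) (s ↑ʳ y) ≡ lookup S (s ↑ʳ y)
    other-side y rewrite lookup-nbhd∩ (x ↑ˡ t) S (s ↑ʳ y) | side-↑ˡ t x | side-↑ʳ s y = refl

  degree-↑ʳ : ∀ y S → ∣ nbhd (K s t) (s ↑ʳ y) ∩ S ∣ ≡ countˡ S
  degree-↑ʳ y S = begin
    ∣ N ∩ S ∣                       ≡⟨ ∣p∣≡count (N ∩ S) ⟩
    count (lookup (N ∩ S))          ≡⟨ sum-↑ s _ ⟩
    countˡ (N ∩ S) + countʳ (N ∩ S) ≡⟨ cong₂ _+_ (count-cong other-side)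
                                                   (trans (count-cong same-side) (count-false t)) ⟩
    countˡ S + 0                    ≡⟨ +-identityʳ _ ⟩
    countˡ S                        ∎
    where
    open ≡-Reasoning
    N : Subset (s + t)
    N = nbhd (K s t) (s ↑ʳ y)
    same-side : ∀ y′ → lookup (N ∩ S) (s ↑ʳ y′) ≡ false
    same-side y′ rewrite lookup-nbhd∩ (s ↑ʳ y) S (s ↑ʳ y′) | side-↑ʳ s y | side-↑ʳ s y′ = refl
    other-side : ∀ x → lookup (N ∩ S) (x ↑ˡ t) ≡ lookup S (x ↑ˡ t)
    other-side x rewrite lookup-nbhd∩ (s ↑ʳ y) S (x ↑ˡ t) | side-↑ʳ s y | side-↑ˡ t x = refl

  isTotalKDom⇔ : ∀ {k S x y} → Fin s → Fin t → countˡ S ≡ x → countʳ S ≡ y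
    → IsTotalKDom (K s t) k S ⇔ Dominating k x y
  isTotalKDom⇔ {k} {S} x₀ y₀ refl refl = mk⇔
    (λ dom → subst (k ≤_) (degree-↑ʳ y₀ S) (dom (s ↑ʳ y₀)) , subst (k ≤_) (degree-↑ˡ x₀ S) (dom (x₀ ↑ˡ t)))
    dominating⇒isTotalKDom
    where
    dominating⇒isTotalKDom : Dominating k (countˡ S) (countʳ S) → IsTotalKDom (K s t) k S
    dominating⇒isTotalKDom (k≤ˡ , k≤ʳ) v with splitView s t v
    ... | inˡ x = subst (k ≤_) (sym (degree-↑ˡ x S)) k≤ʳ
    ... | inʳ y = subst (k ≤_) (sym (degree-↑ʳ y S)) k≤ˡ

  module _ {m} (P : Partition (K s t) m) where

    sizeˡ sizeʳ : Fin m → ℕ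
    sizeˡ = fibre (Partition.label P ∘ (_↑ˡ t))
    sizeʳ = fibre (Partition.label P ∘ (s ↑ʳ_))

    totalKCoalition⇔ : ∀ {k i j} → Fin s → Fin t → TotalKCoalition k P i j ⇔ Coalition k sizeˡ sizeʳ i j
    totalKCoalition⇔ {k} {i} {j} x₀ y₀ = mk⇔
      (λ (i≢j , ¬dᵢ , ¬dⱼ , dᵢⱼ) → coalition i≢j (¬dᵢ ∘ from (part⇔ i)) (¬dⱼ ∘ from (part⇔ j)) (to (part∪⇔ i≢j) dᵢⱼ))
      (λ (coalition i≢j ¬dᵢ ¬dⱼ dᵢⱼ) → i≢j , ¬dᵢ ∘ to (part⇔ i) , ¬dⱼ ∘ to (part⇔ j) , from (part∪⇔ i≢j) dᵢⱼ)
      where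
      open Equivalence
      part⇔ : ∀ i → IsTotalKDom (K s t) k (part P i) ⇔ Dominating k (sizeˡ i) (sizeʳ i)
      part⇔ i = isTotalKDom⇔ x₀ y₀ (count-part P (_↑ˡ t) i) (count-part P (s ↑ʳ_) i)
      part∪⇔ : i ≢ j
        → IsTotalKDom (K s t) k (part P i ∪ part P j) ⇔ Dominating k (sizeˡ i + sizeˡ j) (sizeʳ i + sizeʳ j)
      part∪⇔ i≢j = isTotalKDom⇔ x₀ y₀ (count-part∪ P (_↑ˡ t) i≢j) (count-part∪ P (s ↑ʳ_) i≢j)

    coalitionPartners : ∀ {k} → Fin s → Fin t → IsTotalKCoalitionPartition (K s t) k P
      → ∀ i → ∃ (Coalition k sizeˡ sizeʳ i)
    coalitionPartners x₀ y₀ isTKCP i = map₂ (Equivalence.to (totalKCoalition⇔ x₀ y₀)) (isTKCP i)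

  partition-bound : ∀ {k m} → Fin s → Fin t → s ≤ t
    → (P : Partition (K s t) m) → IsTotalKCoalitionPartition (K s t) k P → m + k ≤ t + 2 ⊎ m + 4 * k ≤ s + t + 4
  partition-bound {k} {m} x₀ y₀ s≤t P isTKCP =
    [ (λ h → inj₁ (≤-trans h (+-monoˡ-≤ 2 s≤t))) , (λ h → h) ]
      (subst₂ (λ σ τ → m + k ≤ σ + 2 ⊎ m + k ≤ τ + 2 ⊎ m + 4 * k ≤ σ + τ + 4)
        (∑-fibre (Partition.label P ∘ (_↑ˡ t))) (∑-fibre (Partition.label P ∘ (s ↑ʳ_)))
        (coalition-bound (coalitionPartners P x₀ y₀ isTKCP) (Partition.label P (x₀ ↑ˡ t))))

  fromLabelling : ∀ {k m} (labelˡ : Fin s → Fin m) (labelʳ : Fin t → Fin m) {α β : Fin m → ℕ}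
    → Fin s → Fin t → fibre labelˡ ≗ α → fibre labelʳ ≗ β → (∀ i → ∃ (Coalition k α β i))
    → HasTotalKCoalitionPartition (K s t) k m
  fromLabelling {m = m} labelˡ labelʳ {α} {β} x₀ y₀ fibreˡ fibreʳ partner =
    P , λ i → map₂ (Equivalence.from (totalKCoalition⇔ P x₀ y₀) ∘ coalition-cong α≗sizeˡ β≗sizeʳ) (partner i)
    where
    label : Fin (s + t) → Fin m
    label = labelˡ ++ labelʳ
    nonempty : ∀ i → ∃ λ v → label v ≡ i
    nonempty i = fibre-∃ label (subst (1 ≤_)
      (sym (trans (fibre-++ labelˡ labelʳ i) (cong₂ _+_ (fibreˡ i) (fibreʳ i))))
      (coalition⇒nonempty (proj₂ (partner i))))
    P : Partition (K s t) m
    P = record { label = label ; nonempty = nonempty }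
    α≗sizeˡ : α ≗ sizeˡ P
    α≗sizeˡ i = sym (trans (fibre-cong (lookup-++ˡ labelˡ labelʳ) i) (fibreˡ i))
    β≗sizeʳ : β ≗ sizeʳ P
    β≗sizeʳ i = sym (trans (fibre-cong (lookup-++ʳ labelˡ labelʳ) i) (fibreʳ i))

-- Extremal partitions

-- The threshold is suc k. Part zero is X together with the first k vertices of Y; the other
-- 1 + d vertices of Y are singletons, each in coalition with part zero.
module BigPartAndSingletons (s k d : ℕ) where

  labelʳ : Fin (k + suc d) → Fin (2 + d)
  labelʳ = k ◃ (λ j → j)

  sizeˡ sizeʳ : Fin (2 + d) → ℕ
  sizeˡ zero    = s
  sizeˡ (suc _) = 0
  sizeʳ zero    = k
  sizeʳ (suc _) = 1

  fibreˡ : fibre {s} (const zero) ≗ sizeˡ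
  fibreˡ zero    = fibre-const s {2 + d} zero
  fibreˡ (suc j) = fibre-∉ {s} (const zero) {suc j} (λ _ ())

  fibreʳ : fibre labelʳ ≗ sizeʳ
  fibreʳ zero    = fibre-◃-zero k (λ j → j)
  fibreʳ (suc j) = trans (fibre-◃-suc k (λ j → j) j) (fibre-injective (λ eq → eq) j)

  zero-with-singleton : suc k ≤ s → ∀ j → Coalition (suc k) sizeˡ sizeʳ zero (suc j)
  zero-with-singleton k<s j = coalition (λ ()) (¬dominatingʳ ≤-refl) (¬dominatingˡ (s≤s z≤n))
    (≤-trans k<s (m≤m+n s 0) , ≤-reflexive (+-comm 1 k))

  partners : suc k ≤ s → ∀ i → ∃ (Coalition (suc k) sizeˡ sizeʳ i)
  partners k<s zero    = suc zero , zero-with-singleton k<s zero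
  partners k<s (suc j) = zero , coalition-sym (zero-with-singleton k<s j)

  partition : suc k ≤ s → HasTotalKCoalitionPartition (K s (k + suc d)) (suc k) (2 + d)
  partition k<s = Bipartite.fromLabelling s (k + suc d) (const zero) labelʳ
    (fromℕ< (≤-trans (s≤s z≤n) k<s)) (k ↑ʳ zero) fibreˡ fibreʳ (partners k<s)

-- The threshold is suc k. Parts zero and one have k + 1 vertices on one side and k on the
-- other; the remaining e vertices of X and d vertices of Y are singletons, in coalition with
-- part zero and part one respectively.
module TwoPartsAndSingletons (k e d : ℕ) where

  labelˡ : Fin (k + (suc k + e)) → Fin (2 + (e + d))
  labelˡ = k ◃ (suc k ◃ (_↑ˡ d))

  labelʳ : Fin (suc k + (k + d)) → Fin (2 + (e + d))
  labelʳ = suc k ◃ (k ◃ (e ↑ʳ_))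

  sizeˡ sizeʳ : Fin (2 + (e + d)) → ℕ
  sizeˡ zero          = k
  sizeˡ (suc zero)    = suc k
  sizeˡ (suc (suc j)) = fibre (_↑ˡ d) j
  sizeʳ zero          = suc k
  sizeʳ (suc zero)    = k
  sizeʳ (suc (suc j)) = fibre (e ↑ʳ_) j

  fibreˡ : fibre labelˡ ≗ sizeˡ
  fibreˡ zero          = fibre-◃-zero k _
  fibreˡ (suc zero)    = trans (fibre-◃-suc k _ zero) (fibre-◃-zero (suc k) _)
  fibreˡ (suc (suc j)) = trans (fibre-◃-suc k _ (suc j)) (fibre-◃-suc (suc k) _ j)

  fibreʳ : fibre labelʳ ≗ sizeʳ
  fibreʳ zero          = fibre-◃-zero (suc k) _
  fibreʳ (suc zero)    = trans (fibre-◃-suc (suc k) _ zero) (fibre-◃-zero k _)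
  fibreʳ (suc (suc j)) = trans (fibre-◃-suc (suc k) _ (suc j)) (fibre-◃-suc k _ j)

  zero-with-one : Coalition (suc k) sizeˡ sizeʳ zero (suc zero)
  zero-with-one = coalition (λ ()) (¬dominatingˡ ≤-refl) (¬dominatingʳ ≤-refl)
    (m≤n+m (suc k) k , m≤m+n (suc k) k)

  partners : ∀ i → ∃ (Coalition (suc k) sizeˡ sizeʳ i)
  partners zero          = suc zero , zero-with-one
  partners (suc zero)    = zero , coalition-sym zero-with-one
  partners (suc (suc j)) with splitView e d j
  ... | inˡ x = zero , coalition-of
    (fibre-injective {e} (λ {x} {y} → ↑ˡ-injective d x y) x) (fibre-∉ {d} (e ↑ʳ_) (λ y → ≢-sym (↑ˡ≢↑ʳ x y)))
    refl refl (λ ()) (¬dominatingʳ (s≤s z≤n)) (¬dominatingˡ ≤-refl) (≤-refl , ≤-refl)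
  ... | inʳ y = suc zero , coalition-of
    (fibre-∉ {e} (_↑ˡ d) (λ x → ↑ˡ≢↑ʳ x y)) (fibre-injective (λ {x} {y} → ↑ʳ-injective e x y) y)
    refl refl (λ ()) (¬dominatingˡ (s≤s z≤n)) (¬dominatingʳ ≤-refl) (≤-refl , ≤-refl)

  partition : HasTotalKCoalitionPartition (K (k + (suc k + e)) (suc k + (k + d))) (suc k) (2 + (e + d))
  partition = Bipartite.fromLabelling (k + (suc k + e)) (suc k + (k + d)) labelˡ labelʳ
    (k ↑ʳ zero) zero fibreˡ fibreʳ partners

partition[t∸k+2] : ∀ {s t k} → 1 ≤ k → k ≤ s → k ≤ t → HasTotalKCoalitionPartition (K s t) k (t ∸ k + 2)
partition[t∸k+2] {s} {k = suc k} _ k≤s k≤t with d , refl ← m≤n⇒∃[o]m+o≡n k≤t =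
  subst₂ (λ t m → HasTotalKCoalitionPartition (K s t) (suc k) m) (+-suc k d) parts
    (BigPartAndSingletons.partition s k d k≤s)
  where
  parts : 2 + d ≡ k + d ∸ k + 2
  parts = sym (trans (cong (_+ 2) (m+n∸m≡n k d)) (+-comm d 2))

partition[s+t+4∸4k] : ∀ {s t k} → 1 ≤ k → k + k ≤ suc s → s ≤ t
  → HasTotalKCoalitionPartition (K s t) k (s + t + 4 ∸ 4 * k)
partition[s+t+4∸4k] {k = suc k} _ (s≤s 2k-1≤s) s≤t
  with s₁ , refl ← m≤n⇒∃[o]m+o≡n (≤-trans (m≤m+n k (suc k)) 2k-1≤s)
  with e  , refl ← m≤n⇒∃[o]m+o≡n (+-cancelˡ-≤ k (suc k) s₁ 2k-1≤s)
  with t₁ , refl ← m≤n⇒∃[o]m+o≡n (≤-trans (m≤n+m (suc k) k) (≤-trans 2k-1≤s s≤t))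
  with d  , refl ← m≤n⇒∃[o]m+o≡n
         (+-cancelˡ-≤ (suc k) k t₁ (≤-trans (≤-reflexive (+-comm (suc k) k)) (≤-trans 2k-1≤s s≤t)))
  = subst (HasTotalKCoalitionPartition _ (suc k)) (sym parts) (TwoPartsAndSingletons.partition k e d)
  where
  expand : ∀ k e d → k + ((1 + k) + e) + ((1 + k) + (k + d)) + 4 ≡ 2 + (e + d) + 4 * (1 + k)
  expand = solve-∀
  parts : k + (suc k + e) + (suc k + (k + d)) + 4 ∸ 4 * suc k ≡ 2 + (e + d)
  parts = trans (cong (_∸ 4 * suc k) (expand k e d)) (m+n∸n≡m _ (4 * suc k))

bound⇒≤t∸k+2 : ∀ {s t k m} → 1 ≤ k → k ≤ t → s ≤ 3 * k ∸ 2
  → m + k ≤ t + 2 ⊎ m + 4 * k ≤ s + t + 4 → m ≤ t ∸ k + 2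
bound⇒≤t∸k+2 {s} {t} {k} {m} 1≤k k≤t s≤3k-2 = [ below , below ∘ reduce ]
  where
  below : m + k ≤ t + 2 → m ≤ t ∸ k + 2
  below h = subst (m ≤_) (+-∸-comm 2 k≤t) (m+n≤o⇒m≤o∸n m h)
  2≤3k : 2 ≤ 3 * k
  2≤3k = ≤-trans (s≤s (s≤s z≤n)) (*-monoʳ-≤ 3 1≤k)
  regroup₁ : ∀ m k → 3 * k + (m + k) ≡ m + 4 * k
  regroup₁ = solve-∀
  regroup₂ : ∀ x t → x + t + 4 ≡ x + 2 + (t + 2)
  regroup₂ = solve-∀
  reduce : m + 4 * k ≤ s + t + 4 → m + k ≤ t + 2
  reduce h = +-cancelˡ-≤ (3 * k) _ _ (begin
    3 * k + (m + k)         ≡⟨ regroup₁ m k ⟩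
    m + 4 * k               ≤⟨ h ⟩
    s + t + 4               ≤⟨ +-monoˡ-≤ 4 (+-monoˡ-≤ t s≤3k-2) ⟩
    3 * k ∸ 2 + t + 4       ≡⟨ regroup₂ (3 * k ∸ 2) t ⟩
    3 * k ∸ 2 + 2 + (t + 2) ≡⟨ cong (_+ (t + 2)) (m∸n+n≡m 2≤3k) ⟩
    3 * k + (t + 2)         ∎)
    where open ≤-Reasoning

bound⇒≤s+t+4∸4k : ∀ {s t k m} → 3 * k ∸ 1 ≤ s
  → m + k ≤ t + 2 ⊎ m + 4 * k ≤ s + t + 4 → m ≤ s + t + 4 ∸ 4 * k
bound⇒≤s+t+4∸4k {s} {t} {k} {m} 3k-1≤s = m+n≤o⇒m≤o∸n m {4 * k} {s + t + 4} ∘ [ enlarge , (λ h → h) ]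
  where
  regroup₁ : ∀ m k → m + 4 * k ≡ m + k + 3 * k
  regroup₁ = solve-∀
  regroup₂ : ∀ s t → t + 2 + (1 + s) ≡ s + t + 3
  regroup₂ = solve-∀
  enlarge : m + k ≤ t + 2 → m + 4 * k ≤ s + t + 4
  enlarge h = begin
    m + 4 * k       ≡⟨ regroup₁ m k ⟩
    m + k + 3 * k   ≤⟨ +-mono-≤ h (≤-trans (m≤n+m∸n (3 * k) 1) (s≤s 3k-1≤s)) ⟩
    t + 2 + (1 + s) ≡⟨ regroup₂ s t ⟩
    s + t + 3       ≤⟨ +-monoʳ-≤ (s + t) (n≤1+n 3) ⟩
    s + t + 4       ∎
    where open ≤-Reasoning

theorem5p3 : (s t k : ℕ) → 1 ≤ k → k ≤ s → s ≤ t →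
    (s ≤ 3 * k ∸ 2 → TCₖ≡ (K s t) k (t ∸ k + 2))
    × (3 * k ∸ 1 ≤ s → TCₖ≡ (K s t) k (s + t + 4 ∸ 4 * k))
theorem5p3 s t k 1≤k k≤s s≤t =
    (λ s≤3k-2 → partition[t∸k+2] 1≤k k≤s k≤t
              , λ m P isTKCP → bound⇒≤t∸k+2 1≤k k≤t s≤3k-2 (bound P isTKCP))
  , (λ 3k-1≤s → partition[s+t+4∸4k] 1≤k (2k≤s+1 3k-1≤s) s≤t
              , λ m P isTKCP → bound⇒≤s+t+4∸4k 3k-1≤s (bound P isTKCP))
  where
  k≤t : k ≤ t
  k≤t = ≤-trans k≤s s≤t
  bound : ∀ {m} (P : Partition (K s t) m) → IsTotalKCoalitionPartition (K s t) k P
    → m + k ≤ t + 2 ⊎ m + 4 * k ≤ s + t + 4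
  bound = Bipartite.partition-bound s t (fromℕ< (≤-trans 1≤k k≤s)) (fromℕ< (≤-trans 1≤k k≤t)) s≤t
  2k≤s+1 : 3 * k ∸ 1 ≤ s → k + k ≤ suc s
  2k≤s+1 3k-1≤s = ≤-trans (+-monoʳ-≤ k (m≤m+n k (k + 0))) (≤-trans (m≤n+m∸n (3 * k) 1) (s≤s 3k-1≤s))
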